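{- For every tree $T$ and every packing sequence $S$, the tree $T$ is $\chi_S$-critical if and only if it is $\chi_S$-vertex-critical.
   Context: All graphs are finite and simple. A packing sequence is an infinite non-decreasing sequence $S=(s_1,s_2,\ldots)$ of positive integers. A map $c:V(G)\to\{1,\ldots,m\}$ is an $S$-packing $m$-coloring if for distinct $u,v$, $c(u)=c(v)=i$ implies $d_G(u,v)>s_i$; $\chi_S(G)$ is the least such $m$. $G$ is $\chi_S$-critical if $\chi_S(H)<\chi_S(G)$ for every proper subgraph $H$ of $G$ (the empty graph is not a subgraph, so $K_1$ is $\chi_S$-critical). $G$ is $\chi_S$-vertex-critical if $\chi_S(G-u)<\chi_S(G)$ for every $u\in V(G)$ ($K_1$ being regarded as $\chi_S$-vertex-critical). -}

module Defs where

open import Data.Nat using (ℕ; zero; suc; _≤_; _<_)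
open import Data.Fin using (Fin; zero; suc; toℕ; punchIn; inject₁; fromℕ)
open import Data.Bool using (Bool; true; false; T)
open import Data.Product using (Σ; ∃; _×_; _,_)
open import Relation.Binary.PropositionalEquality using (_≡_; _≢_)
open import Relation.Nullary using (¬_)
open import Function.Definitions using (Injective; Surjective)

record Graph : Set where
  field
    n      : ℕ
    adj    : Fin n → Fin n → Bool
    sym    : ∀ u v → adj u v ≡ adj v u
    irrefl : ∀ u → adj u u ≡ false

open Graph public

data Walk (G : Graph) : Fin (n G) → Fin (n G) → ℕ → Set where
  here : ∀ u → Walk G u u 0
  step : ∀ {u v w k} → T (adj G u v) → Walk G v w k → Walk G u w (suc k)

DistLe : (G : Graph) → ℕ → Fin (n G) → Fin (n G) → Set
DistLe G s u v = ∃ λ k → k ≤ s × Walk G u v k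

-- d_G(u,v) > s  (also holds when u and v lie in different components, d = ∞)
DistGt : (G : Graph) → ℕ → Fin (n G) → Fin (n G) → Set
DistGt G s u v = ¬ DistLe G s u v

-- Packing sequence S = (s_1, s_2, ...), encoded with s_{i+1} = S i.
IsPackingSequence : (ℕ → ℕ) → Set
IsPackingSequence S = (∀ i → 1 ≤ S i) × (∀ i j → i ≤ j → S i ≤ S j)

-- S-packing m-coloring; colour (j : Fin m) stands for colour (toℕ j + 1),
-- whose distance parameter is s_{toℕ j + 1} = S (toℕ j).
IsSPackingColoring : (S : ℕ → ℕ) (G : Graph) (m : ℕ) → (Fin (n G) → Fin m) → Set
IsSPackingColoring S G m c =
  ∀ u v → u ≢ v → c u ≡ c v → DistGt G (S (toℕ (c u))) u v

HasSPackingColoring : (S : ℕ → ℕ) (G : Graph) (m : ℕ) → Set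
HasSPackingColoring S G m = Σ (Fin (n G) → Fin m) (IsSPackingColoring S G m)

IsChiS : (S : ℕ → ℕ) (G : Graph) (k : ℕ) → Set
IsChiS S G k = HasSPackingColoring S G k × (∀ m → HasSPackingColoring S G m → k ≤ m)

record SubgraphEmbedding (H G : Graph) : Set where
  field
    f       : Fin (n H) → Fin (n G)
    inj     : Injective _≡_ _≡_ f
    edges   : ∀ u v → T (adj H u v) → T (adj G (f u) (f v))

ProperSubgraph : (H G : Graph) → Set
ProperSubgraph H G =
  1 ≤ n H × Σ (SubgraphEmbedding H G) λ e →
    ¬ (Surjective _≡_ _≡_ (SubgraphEmbedding.f e) ×
       (∀ u v → T (adj G (SubgraphEmbedding.f e u) (SubgraphEmbedding.f e v)) → T (adj H u v)))

delete : (G : Graph) → Fin (n G) → Graph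
delete record { n = zero } ()
delete record { n = suc k ; adj = a ; sym = s ; irrefl = i } u = record
  { n = k
  ; adj = λ x y → a (punchIn u x) (punchIn u y)
  ; sym = λ x y → s (punchIn u x) (punchIn u y)
  ; irrefl = λ x → i (punchIn u x)
  }

IsChiSCritical : (S : ℕ → ℕ) (G : Graph) → Set
IsChiSCritical S G =
  ∀ H → ProperSubgraph H G → ∀ a b → IsChiS S H a → IsChiS S G b → a < b

IsChiSVertexCritical : (S : ℕ → ℕ) (G : Graph) → Set
IsChiSVertexCritical S G =
  ∀ u → ∀ a b → IsChiS S (delete G u) a → IsChiS S G b → a < b

Connected : Graph → Set
Connected G = ∀ u v → ∃ λ k → Walk G u v k

-- A cycle of length j+3: distinct vertices c_0,...,c_{j+2}, consecutive ones adjacent,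
-- and c_{j+2} adjacent to c_0.
record Cycle (G : Graph) : Set where
  field
    j      : ℕ
    c      : Fin (suc (suc (suc j))) → Fin (n G)
    inj    : Injective _≡_ _≡_ c
    consec : ∀ (i : Fin (suc (suc j))) → T (adj G (c (inject₁ i)) (c (suc i)))
    close  : T (adj G (c (fromℕ (suc (suc j)))) (c zero))

Acyclic : Graph → Set
Acyclic G = ¬ Cycle G

IsTree : Graph → Set
IsTree G = 1 ≤ n G × Connected G × Acyclic G

-- A vertex-critical tree T is critical: a proper subgraph H of T either misses a vertex z,
-- so that H ⊆ T - z and χ_S(H) ≤ χ_S(T - z) < χ_S(T), or it contains every vertex and misses
-- an edge pq, so that H ⊆ T - pq.  Since pq is a bridge, T - pq is the disjoint union of the
-- component of p, which is a subgraph of T - q, and the component of q, which is a subgraph of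
-- T - p; coloring each component by a restricted optimal coloring of T - q resp. T - p shows
-- χ_S(T - pq) ≤ max (χ_S(T - q), χ_S(T - p)) < χ_S(T).  Conversely every graph on at least two
-- vertices has G - u as a proper subgraph.  As χ_S is only given by its defining property, the
-- argument runs in the double-negation monad and ends by stability of the decidable _<_.
module Submission where

open import Defs hiding (sym)
open import Data.Nat using (ℕ; zero; suc; _+_; _≤_; _<_; _⊔_; z≤n; s≤s; _≤?_; _<?_)
open import Data.Nat.Properties using (≤-<-trans; ⊔-lub; m≤m⊔n; m≤n⊔m; ≰⇒>)
open import Data.Nat.Induction using (<-rec)
open import Data.Fin using (Fin; zero; suc; toℕ; punchIn; punchOut; inject₁; inject≤; fromℕ; _≟_)
open import Data.Fin.Properties
  using (toℕ<n; toℕ-inject≤; inject≤-injective; suc-injective; punchIn-injective; punchInᵢ≢i;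
         punchOut-cong; punchOut-injective; punchIn-punchOut; any?; all?; ¬∀⟶∃¬)
open import Data.Bool using (T; _∧_; not)
open import Data.Bool.Properties using (T-∧)
open import Data.Product using (∃; ∃₂; _×_; _,_; proj₁; proj₂)
import Data.Product as Prod
open import Data.Sum using (_⊎_; inj₁; inj₂; [_,_]′)
import Data.Sum as Sum
open import Data.Empty using (⊥-elim)
open import Effect.Monad using (RawMonad)
open import Level using (0ℓ)
open import Function using (_∘_; case_of_)
open import Function.Bundles using (_⇔_; mk⇔; Equivalence)
open import Function.Definitions using (Injective; Surjective)
open import Relation.Nullary using (¬_; Dec; yes; no; does)
open import Relation.Nullary.Decidable using (decidable-stable; dec-true; dec-false; does-⇔; T?; _→-dec_; _×-dec_; _⊎-dec_)
open import Relation.Nullary.Negation using (¬¬-Monad)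
open import Relation.Binary.PropositionalEquality using (_≡_; _≢_; refl; sym; trans; cong; cong₂; subst; subst₂)

Reachable : (G : Graph) → Fin (n G) → Fin (n G) → Set
Reachable G u v = ∃ (Walk G u v)

module _ {G : Graph} where

  adj-sym : ∀ {u v} → T (adj G u v) → T (adj G v u)
  adj-sym {u} {v} = subst T (Graph.sym G u v)

  adj⇒≢ : ∀ {u v} → T (adj G u v) → u ≢ v
  adj⇒≢ {u} e refl = subst T (irrefl G u) e

  _++ʷ_ : ∀ {u v w k l} → Walk G u v k → Walk G v w l → Walk G u w (k + l)
  here _   ++ʷ W = W
  step e V ++ʷ W = step e (V ++ʷ W)

  reachable-refl : ∀ {u} → Reachable G u u
  reachable-refl = 0 , here _

  reachable-edge : ∀ {u v} → T (adj G u v) → Reachable G u v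
  reachable-edge e = 1 , step e (here _)

  reachable-trans : ∀ {u v w} → Reachable G u v → Reachable G v w → Reachable G u w
  reachable-trans (_ , V) (_ , W) = _ , V ++ʷ W

  reachable-sym : ∀ {u v} → Reachable G u v → Reachable G v u
  reachable-sym (_ , here _)   = reachable-refl
  reachable-sym (_ , step e W) = reachable-trans (reachable-sym (_ , W)) (reachable-edge (adj-sym e))

  vertex : ∀ {u v k} → Walk G u v k → Fin (suc k) → Fin (n G)
  vertex (here u)         _       = u
  vertex (step {u} _ _)   zero    = u
  vertex (step _ W)       (suc i) = vertex W i

  vertex-zero : ∀ {u v k} (W : Walk G u v k) → vertex W zero ≡ u
  vertex-zero (here _)   = refl
  vertex-zero (step _ _) = refl

  vertex-last : ∀ {u v k} (W : Walk G u v k) → vertex W (fromℕ k) ≡ v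
  vertex-last (here _)   = refl
  vertex-last (step _ W) = vertex-last W

  vertex-adjacent : ∀ {u v k} (W : Walk G u v k) (i : Fin k) →
                    T (adj G (vertex W (inject₁ i)) (vertex W (suc i)))
  vertex-adjacent (step e W) zero    = subst (T ∘ adj G _) (sym (vertex-zero W)) e
  vertex-adjacent (step _ W) (suc i) = vertex-adjacent W i

  record Path (u v : Fin (n G)) : Set where
    constructor path
    field
      length           : ℕ
      walk             : Walk G u v length
      vertex-injective : Injective _≡_ _≡_ (vertex walk)

  suffix : ∀ {u v k} (W : Walk G u v k) → Injective _≡_ _≡_ (vertex W) →
           (i : Fin (suc k)) → Path (vertex W i) v
  suffix (here u)   inj zero    = path 0 (here u) inj
  suffix (step e W) inj zero    = path _ (step e W) inj
  suffix (step e W) inj (suc i) = suffix W (suc-injective ∘ inj) i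

  walk⇒path : ∀ {u v k} → Walk G u v k → Path u v
  walk⇒path (here u) = path 0 (here u) λ { {zero} {zero} _ → refl }
  walk⇒path {v = v} (step {u} e W) with walk⇒path W
  ... | path l P inj with any? (λ i → vertex P i ≟ u)
  ...   | yes (i , Pᵢ≡u) = subst (λ x → Path x v) Pᵢ≡u (suffix P inj i)
  ...   | no u∉P         = path (suc l) (step e P) inj′
    where
      inj′ : Injective _≡_ _≡_ (vertex (step e P))
      inj′ {zero}  {zero}  _  = refl
      inj′ {zero}  {suc j} eq = ⊥-elim (u∉P (j , sym eq))
      inj′ {suc i} {zero}  eq = ⊥-elim (u∉P (i , eq))
      inj′ {suc i} {suc j} eq = cong suc (inj eq)

SameEdge : ∀ {m} → Fin m → Fin m → Fin m → Fin m → Set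
SameEdge p q u v = (u ≡ p × v ≡ q) ⊎ (u ≡ q × v ≡ p)

sameEdge? : ∀ {m} (p q u v : Fin m) → Dec (SameEdge p q u v)
sameEdge? p q u v = (u ≟ p ×-dec v ≟ q) ⊎-dec (u ≟ q ×-dec v ≟ p)

SameEdge-sym : ∀ {m} {p q u v : Fin m} → SameEdge p q u v ⇔ SameEdge p q v u
SameEdge-sym = mk⇔ flip flip
  where
    flip : ∀ {m} {p q u v : Fin m} → SameEdge p q u v → SameEdge p q v u
    flip = Sum.swap ∘ Sum.map Prod.swap Prod.swap

deleteEdge : (G : Graph) → Fin (n G) → Fin (n G) → Graph
deleteEdge G p q = record
  { n      = n G
  ; adj    = λ u v → adj G u v ∧ not (does (sameEdge? p q u v))
  ; sym    = λ u v → cong₂ _∧_ (Graph.sym G u v)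
                       (cong not (does-⇔ SameEdge-sym (sameEdge? p q u v) (sameEdge? p q v u)))
  ; irrefl = λ u → cong (_∧ _) (irrefl G u)
  }

module _ {G : Graph} {p q : Fin (n G)} where

  private
    E : Graph
    E = deleteEdge G p q

  deleteEdge-⊆ : ∀ {u v} → T (adj E u v) → T (adj G u v)
  deleteEdge-⊆ = proj₁ ∘ Equivalence.to T-∧

  deleteEdge-keeps : ∀ {u v} → T (adj G u v) → ¬ SameEdge p q u v → T (adj E u v)
  deleteEdge-keeps {u} {v} e ¬pq =
    Equivalence.from T-∧ (e , subst T (cong not (sym (dec-false (sameEdge? p q u v) ¬pq))) _)

  deleteEdge-removes : ¬ T (adj E p q)
  deleteEdge-removes e =
    subst T (cong not (dec-true (sameEdge? p q p q) (inj₁ (refl , refl)))) (proj₂ (Equivalence.to T-∧ e))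

  acyclic⇒bridge : Acyclic G → T (adj G p q) → ¬ Reachable E p q
  acyclic⇒bridge acyclic pq (_ , W) with walk⇒path W
  ... | path zero P _ = adj⇒≢ {G} pq (trans (sym (vertex-zero P)) (vertex-last P))
  ... | path (suc zero) P _ =
    deleteEdge-removes (subst₂ (λ u v → T (adj E u v)) (vertex-zero P) (vertex-last P) (vertex-adjacent P zero))
  ... | path (suc (suc j)) P inj = acyclic record
    { j      = j
    ; c      = vertex P
    ; inj    = inj
    ; consec = deleteEdge-⊆ ∘ vertex-adjacent P
    ; close  = subst₂ (λ u v → T (adj G u v)) (sym (vertex-last P)) (sym (vertex-zero P)) (adj-sym {G} pq)
    }

  -- Cut the walk at its first visit to p or q; the edges before it are not pq.
  reaches-endpoint : ∀ {w l} → Walk G w p l → Reachable E w p ⊎ Reachable E w q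
  reaches-endpoint (here _) = inj₁ reachable-refl
  reaches-endpoint (step {w} {x} e W) with w ≟ p | w ≟ q
  ... | yes refl | _        = inj₁ reachable-refl
  ... | no _     | yes refl = inj₂ reachable-refl
  ... | no w≢p   | no w≢q   =
    Sum.map (reachable-trans wx) (reachable-trans wx) (reaches-endpoint W)
    where
      wx : Reachable E w x
      wx = reachable-edge (deleteEdge-keeps e [ w≢p ∘ proj₁ , w≢q ∘ proj₁ ]′)

remaining : (G : Graph) {y w : Fin (n G)} → y ≢ w → Fin (n (delete G y))
remaining record { n = suc _ } y≢w = punchOut y≢w

remaining-irrelevant : (G : Graph) {y w : Fin (n G)} (h h′ : y ≢ w) → remaining G h ≡ remaining G h′
remaining-irrelevant record { n = suc _ } {y} _ _ = punchOut-cong y refl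

remaining-injective : (G : Graph) {y w w′ : Fin (n G)} (h : y ≢ w) (h′ : y ≢ w′) →
                      remaining G h ≡ remaining G h′ → w ≡ w′
remaining-injective record { n = suc _ } = punchOut-injective

adj-remaining : (G : Graph) {y w w′ : Fin (n G)} (h : y ≢ w) (h′ : y ≢ w′) →
                adj (delete G y) (remaining G h) (remaining G h′) ≡ adj G w w′
adj-remaining record { n = suc _ ; adj = a } h h′ = cong₂ a (punchIn-punchOut h) (punchIn-punchOut h′)

deletion-proper-or-empty : (G : Graph) (u : Fin (n G)) →
                           ProperSubgraph (delete G u) G ⊎ ¬ Fin (n (delete G u))
deletion-proper-or-empty record { n = suc zero }    u = inj₂ λ ()
deletion-proper-or-empty G@record { n = suc (suc _) } u =
  inj₁ (s≤s z≤n , inclusion , λ (surjective , _) → punchInᵢ≢i u _ (proj₂ (surjective u) refl))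
  where
    inclusion : SubgraphEmbedding (delete G u) G
    inclusion = record { f = punchIn u ; inj = punchIn-injective u _ _ ; edges = λ _ _ e → e }

module _ {H G : Graph} (e : SubgraphEmbedding H G) where
  open SubgraphEmbedding e

  embed-walk : ∀ {u v k} → Walk H u v k → Walk G (f u) (f v) k
  embed-walk (here u)    = here (f u)
  embed-walk (step uv W) = step (edges _ _ uv) (embed-walk W)

  coloring-comap : ∀ S {m} → HasSPackingColoring S G m → HasSPackingColoring S H m
  coloring-comap _ (c , valid) =
    c ∘ f , λ u v u≢v same (l , l≤ , W) → valid (f u) (f v) (u≢v ∘ inj) same (l , l≤ , embed-walk W)

  embed-avoiding-vertex : ∀ {z} → (∀ u → f u ≢ z) → SubgraphEmbedding H (delete G z)
  embed-avoiding-vertex {z} z∉f = record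
    { f     = λ u → remaining G (z≢f u)
    ; inj   = λ {u} {v} → inj ∘ remaining-injective G (z≢f u) (z≢f v)
    ; edges = λ u v uv → subst T (sym (adj-remaining G (z≢f u) (z≢f v))) (edges u v uv)
    }
    where
      z≢f : ∀ u → z ≢ f u
      z≢f u = z∉f u ∘ sym

  embed-avoiding-edge : ∀ {u v} → ¬ T (adj H u v) → SubgraphEmbedding H (deleteEdge G (f u) (f v))
  embed-avoiding-edge {u} {v} ¬uv = record
    { f     = f
    ; inj   = inj
    ; edges = λ x y xy → deleteEdge-keeps {G} (edges x y xy) (not-uv xy)
    }
    where
      not-uv : ∀ {x y} → T (adj H x y) → ¬ SameEdge (f u) (f v) (f x) (f y)
      not-uv xy (inj₁ (x≡u , y≡v)) = ¬uv (subst₂ (λ s t → T (adj H s t)) (inj x≡u) (inj y≡v) xy)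
      not-uv xy (inj₂ (x≡v , y≡u)) = ¬uv (adj-sym {H} (subst₂ (λ s t → T (adj H s t)) (inj x≡v) (inj y≡u) xy))

  misses-vertex-or-edge :
    ¬ (Surjective _≡_ _≡_ f × (∀ u v → T (adj G (f u) (f v)) → T (adj H u v))) →
    (∃ λ z → ∀ u → f u ≢ z) ⊎ (∃₂ λ u v → T (adj G (f u) (f v)) × ¬ T (adj H u v))
  misses-vertex-or-edge not-iso with all? (λ z → any? (λ u → f u ≟ z))
  ... | no ¬onto =
    let z , z∉f = ¬∀⟶∃¬ (n G) _ (λ z → any? (λ u → f u ≟ z)) ¬onto in inj₁ (z , λ u fu≡z → z∉f (u , fu≡z))
  ... | yes onto =
    let u , ¬reflects-u = ¬∀⟶∃¬ (n H) _ (λ u → all? (λ v → reflects? u v)) (not-iso ∘ (surjective ,_))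
        v , ¬reflects-uv = ¬∀⟶∃¬ (n H) _ (reflects? u) ¬reflects-u
    in inj₂ (u , v , edge-missing ¬reflects-uv)
    where
      surjective : Surjective _≡_ _≡_ f
      surjective z = let u , fu≡z = onto z in u , λ { refl → fu≡z }
      reflects? : ∀ u v → Dec (T (adj G (f u) (f v)) → T (adj H u v))
      reflects? u v = T? (adj G (f u) (f v)) →-dec T? (adj H u v)
      edge-missing : ∀ {u v} → ¬ (T (adj G (f u) (f v)) → T (adj H u v)) →
                     T (adj G (f u) (f v)) × ¬ T (adj H u v)
      edge-missing {u} {v} ¬reflects with T? (adj G (f u) (f v))
      ... | yes fuv = fuv , λ uv → ¬reflects λ _ → uv
      ... | no ¬fuv = ⊥-elim (¬reflects λ fuv → ⊥-elim (¬fuv fuv))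

coloring-inject≤ : ∀ S {G m m′} → m ≤ m′ → HasSPackingColoring S G m → HasSPackingColoring S G m′
coloring-inject≤ S {G} {m′ = m′} m≤m′ (c , valid) = (λ v → inject≤ (c v) m≤m′) , valid′
  where
    valid′ : IsSPackingColoring S G m′ (λ v → inject≤ (c v) m≤m′)
    valid′ u v u≢v same rewrite toℕ-inject≤ (c u) m≤m′ =
      valid u v u≢v (inject≤-injective m≤m′ m≤m′ (c u) (c v) same)

module _ {G : Graph} {p q : Fin (n G)} where

  private
    E : Graph
    E = deleteEdge G p q

  outside-component : ∀ {y z w} → ¬ Reachable E y z → Reachable E w z → y ≢ w
  outside-component y↛z w→z refl = y↛z w→z

  component-walk : ∀ {y z w w′ l} → ¬ Reachable E y z → Reachable E w z → Walk E w w′ l →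
                   (h : y ≢ w) (h′ : y ≢ w′) → Walk (delete G y) (remaining G h) (remaining G h′) l
  component-walk _ _ (here _) h h′ = subst (λ x → Walk _ _ x 0) (remaining-irrelevant G h h′) (here _)
  component-walk {y} {z} y↛z w→z (step {v = x} wx W) h h′ =
    step (subst T (sym (adj-remaining G h y≢x)) (deleteEdge-⊆ {G} wx)) (component-walk y↛z x→z W y≢x h′)
    where
      x→z : Reachable E x z
      x→z = reachable-trans (reachable-edge (adj-sym {E} wx)) w→z
      y≢x : y ≢ x
      y≢x = outside-component y↛z x→z

  bridge-coloring : ∀ S {m} → Connected G → ¬ Reachable E p q →
                     HasSPackingColoring S (delete G q) m → HasSPackingColoring S (delete G p) m →
                     HasSPackingColoring S E m
  bridge-coloring S {m} connected p↛q (c₁ , valid₁) (c₂ , valid₂) =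
    color ∘ side , λ w w′ → valid (side w) (side w′)
    where
      q↛p : ¬ Reachable E q p
      q↛p = p↛q ∘ reachable-sym

      side : ∀ w → Reachable E w p ⊎ Reachable E w q
      side w = reaches-endpoint (proj₂ (connected w p))

      color : ∀ {w} → Reachable E w p ⊎ Reachable E w q → Fin m
      color (inj₁ w→p) = c₁ (remaining G (outside-component q↛p w→p))
      color (inj₂ w→q) = c₂ (remaining G (outside-component p↛q w→q))

      valid : ∀ {w w′} (σ : Reachable E w p ⊎ Reachable E w q) (σ′ : Reachable E w′ p ⊎ Reachable E w′ q) →
              w ≢ w′ → color σ ≡ color σ′ → DistGt E (S (toℕ (color σ))) w w′
      valid (inj₁ w→p) (inj₁ w′→p) w≢w′ same (l , l≤ , W) =
        valid₁ _ _ (w≢w′ ∘ remaining-injective G _ _) same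
               (l , l≤ , component-walk q↛p w→p W (outside-component q↛p w→p) (outside-component q↛p w′→p))
      valid (inj₂ w→q) (inj₂ w′→q) w≢w′ same (l , l≤ , W) =
        valid₂ _ _ (w≢w′ ∘ remaining-injective G _ _) same
               (l , l≤ , component-walk p↛q w→q W (outside-component p↛q w→q) (outside-component p↛q w′→q))
      valid (inj₁ w→p) (inj₂ w′→q) _ _ (l , _ , W) =
        p↛q (reachable-trans (reachable-sym w→p) (reachable-trans (l , W) w′→q))
      valid (inj₂ w→q) (inj₁ w′→p) _ _ (l , _ , W) =
        q↛p (reachable-trans (reachable-sym w→q) (reachable-trans (l , W) w′→p))

¬¬-least : ∀ {P : ℕ → Set} {m} → P m → ¬ ¬ (∃ λ k → P k × (∀ j → P j → k ≤ j))
¬¬-least {P} {m} pm ¬least = <-rec (λ m → ¬ P m) no-smaller m pm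
  where
    no-smaller : ∀ m → (∀ {j} → j < m → ¬ P j) → ¬ P m
    no-smaller m none-below pm = ¬least (m , pm , λ j pj → case m ≤? j of λ where
      (yes m≤j) → m≤j
      (no m≰j)  → ⊥-elim (none-below (≰⇒> m≰j) pj))

open RawMonad (¬¬-Monad {a = 0ℓ})

IsChiS-¬¬-exists : ∀ S G → ¬ ¬ ∃ (IsChiS S G)
IsChiS-¬¬-exists S G = ¬¬-least {m = n G} ((λ v → v) , λ u v u≢v same _ → u≢v same)

IsChiS-positive : ∀ S {G b} → IsChiS S G b → Fin (n G) → 0 < b
IsChiS-positive _ ((c , _) , _) u = ≤-<-trans z≤n (toℕ<n (c u))

colorable-without-vertices : ∀ S {G} → ¬ Fin (n G) → HasSPackingColoring S G 0
colorable-without-vertices _ no-vertex = ⊥-elim ∘ no-vertex , λ u → ⊥-elim (no-vertex u)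

vertex-critical⇒fewer-colors : ∀ S {G b} → IsChiSVertexCritical S G → IsChiS S G b →
                                ∀ z → ¬ ¬ (∃ λ m → m < b × HasSPackingColoring S (delete G z) m)
vertex-critical⇒fewer-colors S {b = b} vertex-critical χ z = do
  m , χ-z ← IsChiS-¬¬-exists S (delete _ z)
  pure (m , vertex-critical z m b χ-z χ , proj₁ χ-z)

critical⇒vertex-critical : ∀ S G → IsChiSCritical S G → IsChiSVertexCritical S G
critical⇒vertex-critical S G critical u a b χ-u χ with deletion-proper-or-empty G u
... | inj₁ proper = critical (delete G u) proper a b χ-u χ
... | inj₂ empty  = ≤-<-trans (proj₂ χ-u 0 (colorable-without-vertices S empty)) (IsChiS-positive S χ u)

vertex-critical⇒critical : ∀ S G → Connected G → Acyclic G → IsChiSVertexCritical S G → IsChiSCritical S G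
vertex-critical⇒critical S G connected acyclic vertex-critical H (_ , e , not-iso) a b χH χ =
  decidable-stable (a <? b) (case misses-vertex-or-edge e not-iso of λ where
    (inj₁ (z , z∉f)) → do
      m , m<b , col ← fewer z
      pure (≤-<-trans (bound (coloring-comap (embed-avoiding-vertex e z∉f) S col)) m<b)
    (inj₂ (u , v , fuv , ¬uv)) → do
      m₁ , m₁<b , col₁ ← fewer (f v)
      m₂ , m₂<b , col₂ ← fewer (f u)
      let col = bridge-coloring S connected (acyclic⇒bridge acyclic fuv)
                  (coloring-inject≤ S (m≤m⊔n m₁ m₂) col₁) (coloring-inject≤ S (m≤n⊔m m₁ m₂) col₂)
      pure (≤-<-trans (bound (coloring-comap (embed-avoiding-edge e ¬uv) S col)) (⊔-lub m₁<b m₂<b)))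
  where
    open SubgraphEmbedding e using (f)
    fewer : ∀ z → ¬ ¬ (∃ λ m → m < b × HasSPackingColoring S (delete G z) m)
    fewer = vertex-critical⇒fewer-colors S vertex-critical χ
    bound : ∀ {m} → HasSPackingColoring S H m → a ≤ m
    bound = proj₂ χH _

proposition3p5 : (S : ℕ → ℕ) → IsPackingSequence S → (T : Graph) → IsTree T →
                   (IsChiSCritical S T ⇔ IsChiSVertexCritical S T)
proposition3p5 S _ T (_ , connected , acyclic) =
  mk⇔ (critical⇒vertex-critical S T) (vertex-critical⇒critical S T connected acyclic)
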